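{- Let $k\ge 0$ and $n\ge 3k+1$ be integers, and let $w$ be a composition of $n$. Then $w$ has at least $k$ entries equal to $1$ if and only if at least one of the following holds: (1) the composition $1^{n-k}$ (consisting of $n-k$ entries all equal to $1$) is a $k$-deletion of $w$; (2) the longest $k$-deletion of $w$ has length exactly $k$ more than the length of the shortest $k$-deletion of $w$. Moreover, $w$ has exactly $k$ entries equal to $1$ if and only if at least one of (1), (2) holds and $w$ has a $k$-deletion containing no entry equal to $1$.
   Context: A composition is a finite word $w=w(1)w(2)\cdots w(m)$ whose letters are positive integers; its length is $m$, and it is a composition of $n$ if $w(1)+\cdots+w(m)=n$. A $1$-deletion of $w$ is a composition obtained from $w$ either by lowering an entry that is $\ge 2$ by $1$, or by removing an entry equal to $1$. For $k\ge 0$, the $k$-deletions of $w$ are defined recursively: the only $0$-deletion of $w$ is $w$ itself, and a $k$-deletion is a $1$-deletion of a $(k-1)$-deletion. -}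

module Defs where

open import Data.Nat using (ℕ; zero; suc; _+_; _≤_)
open import Data.List using (List; []; _∷_; length; replicate; filter)
open import Data.Nat.ListAction using (sum)
open import Data.List.Relation.Unary.All using (All)
open import Data.Product using (_×_; ∃)
open import Relation.Binary.PropositionalEquality using (_≡_)
open import Data.Nat using (_≟_)

IsComposition : List ℕ → Set
IsComposition w = All (λ a → 1 ≤ a) w

CompositionOf : ℕ → List ℕ → Set
CompositionOf n w = IsComposition w × sum w ≡ n

data Del1 : List ℕ → List ℕ → Set where
  lower  : ∀ {a w} → Del1 (suc (suc a) ∷ w) (suc a ∷ w)
  remove : ∀ {w} → Del1 (1 ∷ w) w
  there  : ∀ {a w v} → Del1 w v → Del1 (a ∷ w) (a ∷ v)

data DelK : ℕ → List ℕ → List ℕ → Set where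
  zero : ∀ {w} → DelK zero w w
  step : ∀ {k w u v} → DelK k w u → Del1 u v → DelK (suc k) w v

ones : List ℕ → ℕ
ones w = length (filter (λ a → a ≟ 1) w)

LongestExceedsShortestBy : ℕ → List ℕ → Set
LongestExceedsShortestBy k w =
  ∃ λ long → ∃ λ short →
    DelK k w long × DelK k w short
    × (∀ v → DelK k w v → length short ≤ length v × length v ≤ length long)
    × length long ≡ length short + k

{-# OPTIONS --safe #-}
-- A deletion step lowers the entry sum by exactly one and the potential 2 · length − #ones by
-- at most one (it drops only when a 2 becomes a 1 or a 1 is removed).
-- If w has at least k ones and k + length w ≤ n, lowering k entries keeps the length while
-- removing k ones costs exactly k entries, and no k-deletion loses more; if k + length w > n,
-- lowering every entry to 1 and then removing ones reaches 1^(n−k) in exactly k steps.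
-- Conversely, under (2) the shortest k-deletion s satisfies length s + k ≤ length w, so the potential
-- bound gives 2 · length w − ones w ≤ k + 2 · length s, whence k ≤ ones w; under (1),
-- length w ≥ n − k while the potential of a composition is at most n, so ones w ≥ n − 2k > k.
-- A one-free k-deletion shows ones w ≤ k, since each step removes at most one 1.
module Submission where

open import Defs
open import Data.Nat
  using (ℕ; zero; suc; _+_; _*_; _∸_; _≤_; _<_; _≤′_; ≤′-reflexive; ≤′-step; z≤n; s≤s; s≤s⁻¹; _≟_; _≤?_)
open import Data.Nat.Properties
open import Data.Nat.ListAction using (sum)
open import Data.Nat.Tactic.RingSolver using (solve-∀)
open import Algebra.Properties.CommutativeSemigroup +-commutativeSemigroup using (interchange)
open import Data.List using (List; []; _∷_; length; replicate)
open import Data.List.Properties using (length-replicate; filter-none)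
open import Data.List.Relation.Unary.All using (All; []; _∷_)
open import Data.Product using (_×_; ∃; _,_; map; map₁; map₂)
open import Data.Sum using (_⊎_; inj₁; inj₂; [_,_])
open import Function.Bundles using (_⇔_; mk⇔)
open import Relation.Binary.PropositionalEquality
  using (_≡_; refl; sym; trans; cong; subst; module ≡-Reasoning)
open import Relation.Nullary using (¬_; yes; no)

private variable
  j k : ℕ
  u v w : List ℕ

-- weight u = 2 · length u − ones u, written as a sum so that no truncated subtraction occurs.
entryWeight : ℕ → ℕ
entryWeight 1 = 1
entryWeight _ = 2

weight : List ℕ → ℕ
weight []      = 0
weight (a ∷ u) = entryWeight a + weight u

+-suc-both : ∀ {a b c} → a + b ≡ c + c → a + suc b ≡ c + suc c
+-suc-both {a} {b} {c} eq = trans (+-suc a b) (trans (cong suc eq) (sym (+-suc c c)))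

ones-+-weight : ∀ u → ones u + weight u ≡ length u + length u
ones-+-weight []                = refl
ones-+-weight (zero ∷ u)        = trans (+-suc (ones u) _) (cong suc (+-suc-both (ones-+-weight u)))
ones-+-weight (1 ∷ u)           = cong suc (+-suc-both (ones-+-weight u))
ones-+-weight (suc (suc _) ∷ u) = trans (+-suc (ones u) _) (cong suc (+-suc-both (ones-+-weight u)))

weight≤sum : IsComposition w → weight w ≤ sum w
weight≤sum []                        = z≤n
weight≤sum {1 ∷ _}           (_ ∷ c) = s≤s (weight≤sum c)
weight≤sum {suc (suc b) ∷ _} (_ ∷ c) = s≤s (s≤s (≤-trans (weight≤sum c) (m≤n+m _ b)))

Del1-length-≤ : Del1 u v → length v ≤ length u
Del1-length-≤ lower     = ≤-refl
Del1-length-≤ remove    = n≤1+n _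
Del1-length-≤ (there d) = s≤s (Del1-length-≤ d)

Del1-length-drop : Del1 u v → length u ≤ suc (length v)
Del1-length-drop lower     = n≤1+n _
Del1-length-drop remove    = ≤-refl
Del1-length-drop (there d) = s≤s (Del1-length-drop d)

Del1-ones-drop : Del1 u v → ones u ≤ suc (ones v)
Del1-ones-drop (lower {zero})          = m≤n+m _ 2
Del1-ones-drop (lower {suc _})         = n≤1+n _
Del1-ones-drop remove                  = ≤-refl
Del1-ones-drop (there {zero} d)        = Del1-ones-drop d
Del1-ones-drop (there {1} d)           = s≤s (Del1-ones-drop d)
Del1-ones-drop (there {suc (suc _)} d) = Del1-ones-drop d

Del1-weight-drop : Del1 u v → weight u ≤ suc (weight v)
Del1-weight-drop (lower {zero})  = ≤-refl
Del1-weight-drop (lower {suc _}) = n≤1+n _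
Del1-weight-drop remove          = ≤-refl
Del1-weight-drop (there {a} d)   =
  ≤-trans (+-monoʳ-≤ (entryWeight a) (Del1-weight-drop d)) (≤-reflexive (+-suc (entryWeight a) _))

module _ (f : List ℕ → ℕ) where

  DelK-antitone : (∀ {u v} → Del1 u v → f v ≤ f u) → DelK k w v → f v ≤ f w
  DelK-antitone f↓ zero       = ≤-refl
  DelK-antitone f↓ (step p d) = ≤-trans (f↓ d) (DelK-antitone f↓ p)

  DelK-bounded-drop : (∀ {u v} → Del1 u v → f u ≤ suc (f v)) → DelK k w v → f w ≤ k + f v
  DelK-bounded-drop f↓ zero               = ≤-refl
  DelK-bounded-drop {suc k} f↓ (step p d) =
    ≤-trans (DelK-bounded-drop f↓ p) (≤-trans (+-monoʳ-≤ k (f↓ d)) (≤-reflexive (+-suc k _)))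

Del1-sum : Del1 u v → sum u ≡ suc (sum v)
Del1-sum lower         = refl
Del1-sum remove        = refl
Del1-sum (there {a} d) = trans (cong (a +_) (Del1-sum d)) (+-suc a _)

DelK-sum : DelK k w v → sum w ≡ k + sum v
DelK-sum zero               = refl
DelK-sum {suc k} (step p d) = trans (DelK-sum p) (trans (cong (k +_) (Del1-sum d)) (+-suc k _))

DelK-reindex : DelK j w v → sum w ≡ k + sum v → DelK k w v
DelK-reindex {j} {w} {v} {k} p eq =
  subst (λ i → DelK i w v) (+-cancelʳ-≡ (sum v) j k (trans (sym (DelK-sum p)) eq)) p

Del1-composition : IsComposition u → Del1 u v → IsComposition v
Del1-composition (_ ∷ c) lower     = s≤s z≤n ∷ c
Del1-composition (_ ∷ c) remove    = c
Del1-composition (x ∷ c) (there d) = x ∷ Del1-composition c d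

DelK-cons : Del1 w u → DelK k u v → DelK (suc k) w v
DelK-cons d zero       = step zero d
DelK-cons d (step p e) = step (DelK-cons d p) e

DelK-trans : DelK j w u → DelK k u v → DelK (k + j) w v
DelK-trans p zero       = p
DelK-trans p (step q d) = step (DelK-trans p q) d

DelK-there : ∀ a → DelK k w v → DelK k (a ∷ w) (a ∷ v)
DelK-there a zero       = zero
DelK-there a (step p d) = step (DelK-there a p) (there d)

DelK-lowerHead : ∀ b → DelK k (1 ∷ u) v → DelK (b + k) (suc b ∷ u) v
DelK-lowerHead zero    p = p
DelK-lowerHead (suc b) p = DelK-cons lower (DelK-lowerHead b p)

flatten : IsComposition w → ∃ λ j → DelK j w (replicate (length w) 1)
flatten []                  = 0 , zero
flatten {suc b ∷ _} (_ ∷ c) = map (b +_) (λ p → DelK-lowerHead b (DelK-there 1 p)) (flatten c)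

dropOnes : ∀ {s t} → t ≤′ s → ∃ λ j → DelK j (replicate s 1) (replicate t 1)
dropOnes (≤′-reflexive refl) = 0 , zero
dropOnes (≤′-step t≤′s)      = map suc (DelK-cons remove) (dropOnes t≤′s)

sum-replicate-1 : ∀ m → sum (replicate m 1) ≡ m
sum-replicate-1 zero    = refl
sum-replicate-1 (suc m) = cong suc (sum-replicate-1 m)

DelK-toOnes : IsComposition w → k ≤ sum w → sum w ≤ k + length w →
              DelK k w (replicate (sum w ∸ k) 1)
DelK-toOnes {w} {k} c k≤n n≤k+len
  with flatten c | dropOnes (≤⇒≤′ (m≤n+o⇒m∸n≤o (sum w) k n≤k+len))
... | _ , p | _ , q = DelK-reindex (DelK-trans p q) (begin
  sum w                             ≡⟨ m+[n∸m]≡n k≤n ⟨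
  k + (sum w ∸ k)                   ≡⟨ cong (k +_) (sum-replicate-1 (sum w ∸ k)) ⟨
  k + sum (replicate (sum w ∸ k) 1) ∎)
  where open ≡-Reasoning

lowerSomeEntry : IsComposition u → length u < sum u → ∃ λ v → Del1 u v × length v ≡ length u
lowerSomeEntry {zero ∷ _}        (() ∷ _) _
lowerSomeEntry {suc (suc b) ∷ u} _        _       = suc b ∷ u , lower , refl
lowerSomeEntry {1 ∷ _}           (_ ∷ c)  (s≤s h) =
  map (1 ∷_) (map there (cong suc)) (lowerSomeEntry c h)

lowerEntries : ∀ k → IsComposition w → k + length w ≤ sum w →
               ∃ λ v → DelK k w v × length v ≡ length w
lowerEntries zero    _ _ = _ , zero , refl
lowerEntries {w} (suc k) c room with lowerSomeEntry c (≤-trans (s≤s (m≤n+m (length w) k)) room)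
... | u , d , len-u =
  map₂ (map (DelK-cons d) (λ len-v → trans len-v len-u)) (lowerEntries k (Del1-composition c d) room′)
  where
  room′ : k + length u ≤ sum u
  room′ = subst (λ l → k + l ≤ sum u) (sym len-u) (s≤s⁻¹ (≤-trans room (≤-reflexive (Del1-sum d))))

removeOnes : ∀ k → k ≤ ones w → ∃ λ v → DelK k w v × length v + k ≡ length w
removeOnes zero    _ = _ , zero , +-identityʳ _
removeOnes {1 ∷ _} (suc k) (s≤s k≤ones) =
  map₂ (map (DelK-cons remove) (λ len-v → trans (+-suc _ k) (cong suc len-v))) (removeOnes k k≤ones)
removeOnes {zero ∷ _} (suc k) k≤ones =
  map (zero ∷_) (map (DelK-there zero) (cong suc)) (removeOnes (suc k) k≤ones)
removeOnes {suc (suc a) ∷ _} (suc k) k≤ones =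
  map (suc (suc a) ∷_) (map (DelK-there _) (cong suc)) (removeOnes (suc k) k≤ones)

removeAllOnes : ∀ w → ∃ λ v → DelK (ones w) w v × All (λ a → ¬ a ≡ 1) v
removeAllOnes []                = [] , zero , []
removeAllOnes (zero ∷ w)        =
  map (zero ∷_) (map (DelK-there zero) ((λ ()) ∷_)) (removeAllOnes w)
removeAllOnes (1 ∷ w)           = map₂ (map₁ (DelK-cons remove)) (removeAllOnes w)
removeAllOnes (suc (suc a) ∷ w) =
  map (suc (suc a) ∷_) (map (DelK-there _) ((λ ()) ∷_)) (removeAllOnes w)

longestExceedsShortestBy : IsComposition w → k + length w ≤ sum w → k ≤ ones w →
                           LongestExceedsShortestBy k w
longestExceedsShortestBy {w} {k} c room k≤ones with lowerEntries k c room | removeOnes k k≤ones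
... | long , p-long , len-long | short , p-short , len-short =
  long , short , p-long , p-short , bounds , trans len-long (sym len-short)
  where
  open ≤-Reasoning
  bounds : ∀ v → DelK k w v → length short ≤ length v × length v ≤ length long
  bounds v p =
    +-cancelʳ-≤ k _ _ (begin
      length short + k ≡⟨ len-short ⟩
      length w         ≤⟨ DelK-bounded-drop length Del1-length-drop p ⟩
      k + length v     ≡⟨ +-comm k _ ⟩
      length v + k     ∎) ,
    subst (length v ≤_) (sym len-long) (DelK-antitone length Del1-length-≤ p)

k≤ones⇒conditions : IsComposition w → 3 * k + 1 ≤ sum w → k ≤ ones w →
                    DelK k w (replicate (sum w ∸ k) 1) ⊎ LongestExceedsShortestBy k w
k≤ones⇒conditions {w} {k} c 3k+1≤n k≤ones with k + length w ≤? sum w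
... | yes room = inj₂ (longestExceedsShortestBy c room k≤ones)
... | no ¬room = inj₁ (DelK-toOnes c k≤n (<⇒≤ (≰⇒> ¬room)))
  where
  k≤n : k ≤ sum w
  k≤n = ≤-trans (≤-trans (m≤m+n k _) (m≤m+n (3 * k) 1)) 3k+1≤n

DelK-replicate⇒k≤ones : IsComposition w → 3 * k + 1 ≤ sum w →
                        DelK k w (replicate (sum w ∸ k) 1) → k ≤ ones w
DelK-replicate⇒k≤ones {w} {k} c 3k+1≤n p = <⇒≤ (+-cancelˡ-≤ (k + k) (suc k) (ones w) (begin
  k + k + suc k  ≡⟨ 2k+[1+k]≡3k+1 k ⟩
  3 * k + 1      ≤⟨ 3k+1≤n ⟩
  n              ≤⟨ n≤2k+ones ⟩
  k + k + ones w ∎))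
  where
  open ≤-Reasoning
  2k+[1+k]≡3k+1 : ∀ k → k + k + suc k ≡ 3 * k + 1
  2k+[1+k]≡3k+1 = solve-∀
  n L : ℕ
  n = sum w
  L = length w
  n≤k+L : n ≤ k + L
  n≤k+L = ≤-trans (m≤n+m∸n n k)
    (+-monoʳ-≤ k (subst (_≤ L) (length-replicate (n ∸ k)) (DelK-antitone length Del1-length-≤ p)))
  n≤2k+ones : n ≤ k + k + ones w
  n≤2k+ones = +-cancelʳ-≤ n _ _ (begin
    n + n                         ≤⟨ +-mono-≤ n≤k+L n≤k+L ⟩
    (k + L) + (k + L)             ≡⟨ interchange k L k L ⟩
    (k + k) + (L + L)             ≡⟨ cong (k + k +_) (ones-+-weight w) ⟨
    (k + k) + (ones w + weight w) ≤⟨ +-monoʳ-≤ (k + k) (+-monoʳ-≤ (ones w) (weight≤sum c)) ⟩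
    (k + k) + (ones w + n)        ≡⟨ +-assoc (k + k) (ones w) n ⟨
    k + k + ones w + n            ∎)

LongestExceedsShortestBy⇒k≤ones : LongestExceedsShortestBy k w → k ≤ ones w
LongestExceedsShortestBy⇒k≤ones {k} {w} (long , short , p-long , p-short , _ , len-long) =
  +-cancelˡ-≤ (L + L + k) k (ones w) (begin
    L + L + k + k                 ≡⟨ +-assoc (L + L) k k ⟩
    (L + L) + (k + k)             ≡⟨ interchange L k L k ⟨
    (L + k) + (L + k)             ≤⟨ +-mono-≤ L+k≤|w| L+k≤|w| ⟩
    length w + length w           ≡⟨ ones-+-weight w ⟨
    ones w + weight w             ≤⟨ +-monoʳ-≤ (ones w) weight-w≤ ⟩
    ones w + (k + (L + L))        ≡⟨ +-comm (ones w) _ ⟩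
    k + (L + L) + ones w          ≡⟨ cong (_+ ones w) (+-comm k (L + L)) ⟩
    L + L + k + ones w            ∎)
  where
  open ≤-Reasoning
  L : ℕ
  L = length short
  L+k≤|w| : L + k ≤ length w
  L+k≤|w| = subst (_≤ length w) len-long (DelK-antitone length Del1-length-≤ p-long)
  weight-w≤ : weight w ≤ k + (L + L)
  weight-w≤ = ≤-trans (DelK-bounded-drop weight Del1-weight-drop p-short)
                (+-monoʳ-≤ k (≤-trans (m≤n+m _ (ones short)) (≤-reflexive (ones-+-weight short))))

conditions⇒k≤ones : IsComposition w → 3 * k + 1 ≤ sum w →
                    DelK k w (replicate (sum w ∸ k) 1) ⊎ LongestExceedsShortestBy k w → k ≤ ones w
conditions⇒k≤ones c 3k+1≤n = [ DelK-replicate⇒k≤ones c 3k+1≤n , LongestExceedsShortestBy⇒k≤ones ]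

DelK-oneFree⇒ones≤k : DelK k w v → All (λ a → ¬ a ≡ 1) v → ones w ≤ k
DelK-oneFree⇒ones≤k {k} p oneFree =
  ≤-trans (DelK-bounded-drop ones Del1-ones-drop p)
    (≤-reflexive (trans (cong (λ xs → k + length xs) (filter-none (_≟ 1) oneFree)) (+-identityʳ k)))

lemma2 : (k n : ℕ) → 3 * k + 1 ≤ n → (w : List ℕ) → CompositionOf n w →
    ((k ≤ ones w) ⇔ (DelK k w (replicate (n ∸ k) 1) ⊎ LongestExceedsShortestBy k w))
    × ((ones w ≡ k) ⇔ ((DelK k w (replicate (n ∸ k) 1) ⊎ LongestExceedsShortestBy k w)
                        × ∃ λ v → DelK k w v × All (λ a → ¬ (a ≡ 1)) v))
lemma2 k n 3k+1≤n w (c , refl) =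
  mk⇔ (k≤ones⇒conditions c 3k+1≤n) (conditions⇒k≤ones c 3k+1≤n) ,
  mk⇔ (λ { refl → k≤ones⇒conditions c 3k+1≤n ≤-refl , removeAllOnes w })
      (λ (conds , _ , p , oneFree) →
         ≤-antisym (DelK-oneFree⇒ones≤k p oneFree) (conditions⇒k≤ones c 3k+1≤n conds))
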